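{- Let $n\ge1$ be an integer not divisible by $3$ and let $\Pi$ be a $(3,n)$-Dyck path. Every cell $x\in\lambda(\Pi)$ lying in the second column satisfies $\frac{\operatorname{arm}(x)}{\operatorname{leg}(x)+1}<\frac{3}{n}<\frac{\operatorname{arm}(x)+1}{\operatorname{leg}(x)}$, and hence contributes to $\operatorname{dinv}(\Pi)$.
   Context: A $(3,n)$-Dyck path is a lattice path from $(0,0)$ to $(3,n)$ using unit north and east steps that stays weakly above the line $y=\frac{n}{3}x$. The cell $(a,b)$ ($a\in\{1,2,3\}$ column from left, $b\in\{1,\dots,n\}$ row from bottom) is $[a-1,a]\times[b-1,b]$. $\lambda(\Pi)$ is the set of cells lying above (north-west of) $\Pi$. For $x\in\lambda(\Pi)$, $\operatorname{arm}(x)$ (resp. $\operatorname{leg}(x)$) is the number of cells of $\lambda(\Pi)$ strictly east (resp. strictly south) of $x$ in its row (resp. column); a fraction with denominator $0$ is read as $+\infty$. $\operatorname{dinv}(\Pi)$ is the number of $x\in\lambda(\Pi)$ satisfying the displayed double inequality. -}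

module Defs where

open import Data.Nat using (ℕ; zero; suc; _+_; _*_; _≤_; _<_; _<ᵇ_)
open import Data.Bool using (Bool; true; false; _∧_; if_then_else_; T)
open import Data.List using (List; []; _∷_; take; upTo)
open import Data.Integer using (+_)
open import Data.Rational using (ℚ; _/_)
import Data.Rational as Q
open import Relation.Binary.PropositionalEquality using (_≡_)

-- A lattice path is a word in unit steps: N = (0,1), E = (1,0).
data Step : Set where
  N E : Step

countN : List Step → ℕ
countN []       = 0
countN (N ∷ p) = suc (countN p)
countN (E ∷ p) = countN p

countE : List Step → ℕ
countE []       = 0
countE (N ∷ p) = countE p
countE (E ∷ p) = suc (countE p)

-- (3,n)-Dyck path: from (0,0) to (3,n) (3 east steps, n north steps),
-- and every lattice point (x,y) on the path (= endpoint of some prefix)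
-- satisfies y ≥ (n/3) x, i.e. n * x ≤ 3 * y.  (Checking the vertices
-- suffices since the steps are straight segments.)
record Dyck (n : ℕ) (p : List Step) : Set where
  field
    east  : countE p ≡ 3
    north : countN p ≡ n
    above : ∀ k → n * countE (take k p) ≤ 3 * countN (take k p)

-- eastHeight i p : the y-coordinate of the (i+1)-th east step of p
-- (number of north steps preceding it).
eastHeight : ℕ → List Step → ℕ
eastHeight i       []      = 0
eastHeight i       (N ∷ p) = suc (eastHeight i p)
eastHeight zero    (E ∷ p) = 0
eastHeight (suc i) (E ∷ p) = eastHeight i p

-- Cell (a,b) = [a-1,a]×[b-1,b], with 1 ≤ a ≤ 3, 1 ≤ b ≤ n, lies above
-- (north-west of) the path iff the east step of the path in column a
-- has height ≤ b-1, i.e. eastHeight (a-1) p < b.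
inLamᵇ : ℕ → List Step → ℕ → ℕ → Bool
inLamᵇ n p zero    b = false
inLamᵇ n p (suc i) b = (suc i <ᵇ 4) ∧ (0 <ᵇ b) ∧ (b <ᵇ suc n) ∧ (eastHeight i p <ᵇ b)

InLam : ℕ → List Step → ℕ → ℕ → Set
InLam n p a b = T (inLamᵇ n p a b)

count : (ℕ → Bool) → List ℕ → ℕ
count f []       = 0
count f (x ∷ xs) = (if f x then 1 else 0) + count f xs

arm : ℕ → List Step → ℕ → ℕ → ℕ
arm n p a b = count (λ a' → (a <ᵇ a') ∧ inLamᵇ n p a' b) (upTo 4)

leg : ℕ → List Step → ℕ → ℕ → ℕ
leg n p a b = count (λ b' → (b' <ᵇ b) ∧ inLamᵇ n p a b') (upTo (suc n))

-- Nonnegative rationals extended by +∞; a fraction with denominator 0 is +∞.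
data ℚ∞ : Set where
  fin : ℚ → ℚ∞
  ∞   : ℚ∞

data _<∞_ : ℚ∞ → ℚ∞ → Set where
  fin<fin : ∀ {q r} → q Q.< r → fin q <∞ fin r
  fin<∞   : ∀ {q} → fin q <∞ ∞

frac : ℕ → ℕ → ℚ∞
frac a zero    = ∞
frac a (suc d) = fin ((+ a) / suc d)

DinvCell : ℕ → List Step → ℕ → ℕ → Set
DinvCell n p a b =
  (frac (arm n p a b) (suc (leg n p a b)) <∞ frac 3 n)
  × (frac 3 n <∞ frac (suc (arm n p a b)) (leg n p a b))
  where open import Data.Product using (_×_)

-- A cell (2,b) of λ(Π) sits strictly above the second east step, at height h₁ ≥ 2n/3, and no
-- higher than row n.  The third east step has height ≥ n, so column 3 of λ(Π) is empty and
-- arm = 0, while leg ≤ b − 1 − h₁ ≤ n − 1 − h₁ < n/3.  The dinv inequalities then read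
-- 0 < 3/n and 3 leg < n.
module Submission where

open import Defs
open import Data.Nat using (ℕ; zero; suc; _+_; _*_; _∸_; _≤_; _<_; _<ᵇ_; z≤n; s≤s)
open import Data.Nat.Properties
open import Data.Nat.Divisibility using (_∣_)
open import Data.Nat.Tactic.RingSolver using (solve-∀)
open import Data.List using (List; []; _∷_; take; upTo; _++_)
open import Data.List.Properties using (applyUpTo-∷ʳ)
open import Relation.Nullary using (¬_)
open import Data.Bool using (Bool; true; false; _∧_; if_then_else_; T)
open import Data.Bool.Properties using (T-∧)
open import Data.Product using (_×_; _,_; proj₁; proj₂; Σ-syntax)
open import Data.Empty using (⊥-elim)
open import Function.Bundles using (Equivalence)
open import Relation.Binary.PropositionalEquality
import Data.Integer as ℤ
import Data.Integer.Properties as ℤ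
import Data.Rational as ℚ
import Data.Rational.Properties as ℚ
import Data.Rational.Unnormalised as ℚᵘ
import Data.Rational.Unnormalised.Properties as ℚᵘ

/-<-cross : ∀ a c b d → a * suc d < b * suc c → (ℤ.+ a) ℚ./ suc c ℚ.< (ℤ.+ b) ℚ./ suc d
/-<-cross a c b d lt = ℚ.toℚᵘ-cancel-<
  (ℚᵘ.<-respʳ-≃ (ℚᵘ.≃-sym (ℚ.toℚᵘ-fromℚᵘ (ℚᵘ.mkℚᵘ (ℤ.+ b) d)))
    (ℚᵘ.<-respˡ-≃ (ℚᵘ.≃-sym (ℚ.toℚᵘ-fromℚᵘ (ℚᵘ.mkℚᵘ (ℤ.+ a) c)))
      (ℚᵘ.*<* (subst₂ ℤ._<_ (ℤ.pos-* a (suc d)) (ℤ.pos-* b (suc c)) (ℤ.+<+ lt)))))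

take-through-east : ∀ i p → i < countE p →
  Σ[ k ∈ ℕ ] countE (take k p) ≡ suc i × countN (take k p) ≡ eastHeight i p
take-through-east i       (N ∷ p) lt with take-through-east i p lt
... | k , e , h = suc k , e , cong suc h
take-through-east zero    (E ∷ p) lt = 1 , refl , refl
take-through-east (suc i) (E ∷ p) (s≤s lt) with take-through-east i p lt
... | k , e , h = suc k , cong suc e , h

Dyck⇒eastHeight-≥ : ∀ {n p} → Dyck n p → ∀ i → i < 3 → n * suc i ≤ 3 * eastHeight i p
Dyck⇒eastHeight-≥ {n} {p} d i i<3
  with take-through-east i p (subst (i <_) (sym (Dyck.east d)) i<3)
... | k , e , h = subst₂ (λ x y → n * x ≤ 3 * y) e h (Dyck.above d k)

InLam⇒bounds : ∀ {n p i b} → InLam n p (suc i) b → eastHeight i p < b × b ≤ n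
InLam⇒bounds {n} {p} {i} {b} t
  with Equivalence.to (T-∧ {i <ᵇ 3}) t
... | _ , t₁ with Equivalence.to (T-∧ {0 <ᵇ b}) t₁
... | _ , t₂ with Equivalence.to (T-∧ {b <ᵇ suc n}) t₂
... | b<1+n , h<b = <ᵇ⇒< (eastHeight i p) b h<b , ≤-pred (<ᵇ⇒< b (suc n) b<1+n)

arm-column₂≡0 : ∀ {n p} → Dyck n p → ∀ b → arm n p 2 b ≡ 0
arm-column₂≡0 {n} {p} d b with inLamᵇ n p 3 b in eq
... | false = refl
... | true with InLam⇒bounds {n} {p} {2} {b} (subst T (sym eq) _)
...   | h<b , b≤n = ⊥-elim (<⇒≱ h<b (≤-trans b≤n n≤h))
  where
  n≤h : n ≤ eastHeight 2 p
  n≤h = *-cancelˡ-≤ 3 (subst (_≤ 3 * eastHeight 2 p) (*-comm n 3)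
                          (Dyck⇒eastHeight-≥ d 2 (s≤s (s≤s (s≤s z≤n)))))

count-++ : ∀ f xs ys → count f (xs ++ ys) ≡ count f xs + count f ys
count-++ f []       ys = refl
count-++ f (x ∷ xs) ys =
  trans (cong ([x] +_) (count-++ f xs ys)) (sym (+-assoc [x] (count f xs) (count f ys)))
  where
  [x] : ℕ
  [x] = if f x then 1 else 0

count-upTo-suc : ∀ f m → count f (upTo (suc m)) ≡ count f (upTo m) + (if f m then 1 else 0)
count-upTo-suc f m = begin
  count f (upTo (suc m))           ≡⟨ cong (count f) (applyUpTo-∷ʳ (λ x → x) m) ⟨
  count f (upTo m ++ m ∷ [])       ≡⟨ count-++ f (upTo m) (m ∷ []) ⟩
  count f (upTo m) + (_ + 0)       ≡⟨ cong (count f (upTo m) +_) (+-identityʳ _) ⟩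
  count f (upTo m) + (if f m then 1 else 0) ∎
  where open ≡-Reasoning

count-upTo-≤-∸ : ∀ f l → (∀ x → T (f x) → l ≤ x) → ∀ m → count f (upTo m) ≤ m ∸ l
count-upTo-≤-∸ f l above zero = z≤n
count-upTo-≤-∸ f l above (suc m) rewrite count-upTo-suc f m with f m in eq
... | false = ≤-trans (≤-reflexive (+-identityʳ _))
                (≤-trans (count-upTo-≤-∸ f l above m) (∸-monoˡ-≤ l (n≤1+n m)))
... | true  = begin
  count f (upTo m) + 1 ≡⟨ +-comm _ 1 ⟩
  suc (count f (upTo m)) ≤⟨ s≤s (count-upTo-≤-∸ f l above m) ⟩
  suc (m ∸ l)          ≡⟨ +-∸-assoc 1 (above m (subst T (sym eq) _)) ⟨
  suc m ∸ l            ∎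
  where open ≤-Reasoning

count-upTo-stable : ∀ f c → (∀ x → T (f x) → x < c) →
  ∀ m → c ≤ m → count f (upTo m) ≡ count f (upTo c)
count-upTo-stable f c below m c≤m with m≤n⇒∃[o]m+o≡n c≤m
... | k , refl = count-upTo-c+ k
  where
  count-upTo-c+ : ∀ k → count f (upTo (c + k)) ≡ count f (upTo c)
  count-upTo-c+ zero rewrite +-identityʳ c = refl
  count-upTo-c+ (suc k) rewrite +-suc c k | count-upTo-suc f (c + k) with f (c + k) in eq
  ... | false = trans (+-identityʳ _) (count-upTo-c+ k)
  ... | true  = ⊥-elim (<⇒≱ (below (c + k) (subst T (sym eq) _)) (m≤m+n c k))

leg-column₂-≤ : ∀ n p b → b ≤ suc n → leg n p 2 b ≤ b ∸ suc (eastHeight 1 p)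
leg-column₂-≤ n p b b≤1+n = begin
  count f (upTo (suc n)) ≡⟨ count-upTo-stable f b below (suc n) b≤1+n ⟩
  count f (upTo b)       ≤⟨ count-upTo-≤-∸ f (suc (eastHeight 1 p)) above b ⟩
  b ∸ suc (eastHeight 1 p) ∎
  where
  open ≤-Reasoning
  f : ℕ → Bool
  f b' = (b' <ᵇ b) ∧ inLamᵇ n p 2 b'
  below : ∀ x → T (f x) → x < b
  below x t = <ᵇ⇒< x b (proj₁ (Equivalence.to (T-∧ {x <ᵇ b}) t))
  above : ∀ x → T (f x) → eastHeight 1 p < x
  above x t = proj₁ (InLam⇒bounds {n} {p} {1} {x} (proj₂ (Equivalence.to (T-∧ {x <ᵇ b}) t)))

3*gap<n : ∀ n h l → l + suc h ≤ n → n * 2 ≤ 3 * h → 3 * l < n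
3*gap<n n h l gap 2n≤3h =
  <-≤-trans (m<m+n (3 * l) {3} (s≤s z≤n)) (+-cancelʳ-≤ (n * 2) (3 * l + 3) n (begin
  3 * l + 3 + n * 2 ≤⟨ +-monoʳ-≤ (3 * l + 3) 2n≤3h ⟩
  3 * l + 3 + 3 * h ≡⟨ expand l h ⟩
  3 * (l + suc h)   ≤⟨ *-monoʳ-≤ 3 gap ⟩
  3 * n             ≡⟨ split n ⟩
  n + n * 2         ∎))
  where
  open ≤-Reasoning
  expand : ∀ l h → 3 * l + 3 + 3 * h ≡ 3 * (l + suc h)
  expand = solve-∀
  split : ∀ n → 3 * n ≡ n + n * 2
  split = solve-∀

DinvCell-of-arm≡0 : ∀ {n p a b} → arm (suc n) p a b ≡ 0 → 3 * leg (suc n) p a b < suc n →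
  DinvCell (suc n) p a b
DinvCell-of-arm≡0 {n} {p} {a} {b} arm≡0 3leg<n rewrite arm≡0 with leg (suc n) p a b
... | zero  = fin<fin (/-<-cross 0 0 3 n (s≤s z≤n)) , fin<∞
... | suc l = fin<fin (/-<-cross 0 (suc l) 3 n (s≤s z≤n))
            , fin<fin (/-<-cross 3 n 1 l (subst (3 * suc l <_) (sym (*-identityˡ (suc n))) 3leg<n))

mainTheorem4 : (n : ℕ) → 1 ≤ n → ¬ (3 ∣ n) → (p : List Step) → Dyck n p →
    (b : ℕ) → InLam n p 2 b → DinvCell n p 2 b
mainTheorem4 (suc n) _ _ p d b cell with InLam⇒bounds {suc n} {p} {1} {b} cell
... | h<b , b≤n = DinvCell-of-arm≡0 {n} {p} {2} {b} (arm-column₂≡0 d b)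
                    (3*gap<n (suc n) h (leg (suc n) p 2 b) gap 2n≤3h)
  where
  h : ℕ
  h = eastHeight 1 p
  2n≤3h : suc n * 2 ≤ 3 * h
  2n≤3h = Dyck⇒eastHeight-≥ d 1 (s≤s (s≤s z≤n))
  gap : leg (suc n) p 2 b + suc h ≤ suc n
  gap = ≤-trans (+-monoˡ-≤ (suc h) (leg-column₂-≤ (suc n) p b (m≤n⇒m≤1+n b≤n)))
                (≤-trans (≤-reflexive (m∸n+n≡m h<b)) b≤n)
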